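{- For all integers $k\ge 4$ and $q\ge 1$, the graph $G(q,k)$ is $(K_3+P_1)$-free.
   Context: For integers $q\ge 1$ and $k\ge 3$, $G(q,k)$ is the graph on vertex set $\{v_0,v_1,\dots,v_{kq}\}$ in which, with all indices taken modulo $kq+1$, the neighbourhood of $v_i$ is $\{v_{i-1},v_{i+1}\}\cup\{v_{i+kj+m} : m=2,3,\dots,k-1,\ j=0,1,\dots,q-1\}$. $K_3+P_1$ is the disjoint union of a triangle and a single isolated vertex. A graph is $H$-free if it contains no induced subgraph isomorphic to $H$. -}

module Defs where

open import Data.Nat using (ℕ; zero; suc; _+_; _*_; _∸_; _≤_; _<_)
open import Data.Nat.DivMod using (_%_)
open import Data.Fin using (Fin; toℕ)
open import Data.Product using (Σ; _×_; ∃-syntax)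
open import Data.Sum using (_⊎_)
open import Relation.Binary.PropositionalEquality using (_≡_; _≢_)
open import Relation.Nullary using (¬_)
open import Function.Bundles using (_⇔_)
open import Level using (0ℓ)

record Graph : Set₁ where
  field
    V   : Set
    Adj : V → V → Set
open Graph public

InducedSub : Graph → Graph → Set
InducedSub H G =
  Σ (V H → V G) λ f →
    (∀ x y → f x ≡ f y → x ≡ y) ×
    (∀ x y → Adj H x y ⇔ Adj G (f x) (f y))

_-free : Graph → Graph → Set
(H -free) G = ¬ InducedSub H G

-- Adjacency, indices modulo n = kq+1:
--   v_j ∈ N(v_i)  iff  j ≡ i-1, or j ≡ i+1, or j ≡ i + k·j' + m
--   for some m ∈ {2,…,k-1}, j' ∈ {0,…,q-1}.
-- (i-1 mod n is written (i + kq) mod n.)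
GAdj : (q k : ℕ) → Fin (suc (k * q)) → Fin (suc (k * q)) → Set
GAdj q k i j =
  (toℕ j ≡ (toℕ i + k * q) % suc (k * q)) ⊎
  (toℕ j ≡ (toℕ i + 1) % suc (k * q)) ⊎
  (∃[ m ] ∃[ j' ] (2 ≤ m × m ≤ k ∸ 1 × j' < q ×
      toℕ j ≡ (toℕ i + (k * j' + m)) % suc (k * q)))

G : ℕ → ℕ → Graph
G q k = record { V = Fin (suc (k * q)) ; Adj = GAdj q k }

K3P1Adj : Fin 4 → Fin 4 → Set
K3P1Adj x y = (toℕ x < 3) × (toℕ y < 3) × (x ≢ y)

K3+P1 : Graph
K3+P1 = record { V = Fin 4 ; Adj = K3P1Adj }

-- Measure each vertex v by its offset p ∈ [0, n) from a fixed vertex x, v ≡ x + p (mod n = kq + 1).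
-- G(q,k) is the circulant graph on ℤ/n with connection set {kq, 1} ∪ {kj + m : 2 ≤ m < k, j < q},
-- so a non-neighbour of x has offset residue 0 or 1 mod k. Adjacent vertices at nonzero offsets
-- differ by a connection c or by n − c, again a connection; a connection is either kq, too long to
-- fit between two nonzero offsets, or not divisible by k. So adjacent non-neighbours of x have
-- distinct residues in {0, 1}, and no three of them form a triangle.
module Submission where

open import Defs
open import Data.Nat using (ℕ; suc; _+_; _*_; _∸_; _≤_; _<_; z≤n; s≤s; z<s; s<s; _≤?_; _<?_; NonZero; >-nonZero)
open import Data.Nat.Properties
open import Data.Nat.DivMod
open import Data.Nat.Divisibility using (_∣_; _∤_; divides; ∣m+n∣m⇒∣n; m∣m*n; ∣1⇒≡1; ∣⇒≤)
open import Data.Nat.Tactic.RingSolver using (solve-∀)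
open import Data.Fin using (Fin; toℕ; #_)
open import Data.Fin.Properties using (toℕ-injective; toℕ<n)
open import Data.Product using (_×_; _,_; proj₁; proj₂; ∃-syntax)
open import Data.Sum using (_⊎_; inj₁; inj₂)
open import Data.Empty using (⊥; ⊥-elim)
open import Relation.Nullary using (¬_; yes; no)
open import Relation.Binary.PropositionalEquality
open import Function.Bundles using (Equivalence)

<⇒≤∸1 : ∀ {m n} → m < n → m ≤ n ∸ 1
<⇒≤∸1 (s≤s m≤n) = m≤n

≤∸1⇒< : ∀ {m n} .{{_ : NonZero n}} → m ≤ n ∸ 1 → m < n
≤∸1⇒< {n = suc _} = s≤s

no-three-distinct-≤1 : ∀ {a b c} → a ≤ 1 → b ≤ 1 → c ≤ 1 → b ≢ a → c ≢ a → c ≢ b → ⊥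
no-three-distinct-≤1 z≤n       z≤n       _         b≢a _   _   = b≢a refl
no-three-distinct-≤1 (s≤s z≤n) (s≤s z≤n) _         b≢a _   _   = b≢a refl
no-three-distinct-≤1 z≤n       (s≤s z≤n) z≤n       _   c≢a _   = c≢a refl
no-three-distinct-≤1 (s≤s z≤n) z≤n       (s≤s z≤n) _   c≢a _   = c≢a refl
no-three-distinct-≤1 z≤n       (s≤s z≤n) (s≤s z≤n) _   _   c≢b = c≢b refl
no-three-distinct-≤1 (s≤s z≤n) z≤n       z≤n       _   _   c≢b = c≢b refl

module _ {d : ℕ} .{{_ : NonZero d}} where

  [m%d+n]%d≡[m+n]%d : ∀ m n → (m % d + n) % d ≡ (m + n) % d
  [m%d+n]%d≡[m+n]%d m n = begin
    (m % d + n) % d          ≡⟨ %-distribˡ-+ (m % d) n d ⟩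
    (m % d % d + n % d) % d  ≡⟨ cong (λ r → (r + n % d) % d) (m%n%n≡m%n m d) ⟩
    (m % d + n % d) % d      ≡⟨ %-distribˡ-+ m n d ⟨
    (m + n) % d              ∎
    where open ≡-Reasoning

  [m+n]%d≡m%d⇒d∣n : ∀ m n → (m + n) % d ≡ m % d → d ∣ n
  [m+n]%d≡m%d⇒d∣n m n eq = ∣m+n∣m⇒∣n (divides ((m + n) / d) sum) (divides (m / d) refl)
    where
      open ≡-Reasoning
      sum : (m / d) * d + n ≡ ((m + n) / d) * d
      sum = +-cancelˡ-≡ (m % d) _ _ (begin
        m % d + ((m / d) * d + n)  ≡⟨ +-assoc (m % d) _ n ⟨
        m % d + (m / d) * d + n    ≡⟨ cong (_+ n) (m≡m%n+[m/n]*n m d) ⟨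
        m + n                      ≡⟨ m≡m%n+[m/n]*n (m + n) d ⟩
        (m + n) % d + ((m + n) / d) * d  ≡⟨ cong (_+ ((m + n) / d) * d) eq ⟩
        m % d + ((m + n) / d) * d  ∎)

module _ {N : ℕ} where

  private
    n : ℕ
    n = suc N

  +-cancelˡ-% : ∀ x s t → (x + s) % n ≡ (x + t) % n → s % n ≡ t % n
  +-cancelˡ-% x s t eq = begin
    s % n                     ≡⟨ shift s ⟩
    ((x + s) % n + x * N) % n ≡⟨ cong (λ r → (r + x * N) % n) eq ⟩
    ((x + t) % n + x * N) % n ≡⟨ shift t ⟨
    t % n                     ∎
    where
      open ≡-Reasoning
      multiples : ∀ s x N → s + x * suc N ≡ (x + s) + x * N
      multiples = solve-∀
      shift : ∀ s → s % n ≡ ((x + s) % n + x * N) % n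
      shift s = begin
        s % n                     ≡⟨ [m+kn]%n≡m%n s x n ⟨
        (s + x * n) % n           ≡⟨ cong (_% n) (multiples s x N) ⟩
        ((x + s) + x * N) % n     ≡⟨ [m%d+n]%d≡[m+n]%d (x + s) (x * N) ⟨
        ((x + s) % n + x * N) % n ∎

  m<n+n⇒m%n≡m⊎m%n+n≡m : ∀ m → m < n + n → m % n ≡ m ⊎ m % n + n ≡ m
  m<n+n⇒m%n≡m⊎m%n+n≡m m m<n+n with m <? n
  ... | yes m<n = inj₁ (m<n⇒m%n≡m m<n)
  ... | no m≮n with m≤n⇒∃[o]m+o≡n (≮⇒≥ m≮n)
  ... | r , refl = inj₂ (begin
    (n + r) % n  + n ≡⟨ cong (_+ n) (trans (cong (_% n) (+-comm n r)) ([m+n]%n≡m%n r n)) ⟩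
    r % n + n        ≡⟨ cong (_+ n) (m<n⇒m%n≡m (+-cancelˡ-< n r n m<n+n)) ⟩
    r + n            ≡⟨ +-comm r n ⟩
    n + r            ∎)
    where open ≡-Reasoning

  offset-exists : ∀ {x v} → x < n → v < n → ∃[ p ] p < n × v ≡ (x + p) % n
  offset-exists {x} {v} x<n v<n = (v + (n ∸ x)) % n , m%n<n (v + (n ∸ x)) n , sym (begin
    (x + (v + (n ∸ x)) % n) % n ≡⟨ cong (_% n) (+-comm x _) ⟩
    ((v + (n ∸ x)) % n + x) % n ≡⟨ [m%d+n]%d≡[m+n]%d (v + (n ∸ x)) x ⟩
    (v + (n ∸ x) + x) % n       ≡⟨ cong (_% n) (+-assoc v (n ∸ x) x) ⟩
    (v + (n ∸ x + x)) % n       ≡⟨ cong (λ m → (v + m) % n) (m∸n+n≡m (<⇒≤ x<n)) ⟩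
    (v + n) % n                 ≡⟨ [m+n]%n≡m%n v n ⟩
    v % n                       ≡⟨ m<n⇒m%n≡m v<n ⟩
    v                           ∎)
    where open ≡-Reasoning

  offset-+ : ∀ {x u w p p′ c} → p′ < n → u ≡ (x + p) % n → w ≡ (x + p′) % n →
             w ≡ (u + c) % n → p′ ≡ (p + c) % n
  offset-+ {x} {u} {w} {p} {p′} {c} p′<n refl w≡x+p′ w≡u+c = begin
    p′               ≡⟨ m<n⇒m%n≡m p′<n ⟨
    p′ % n           ≡⟨ +-cancelˡ-% x p′ (p + c) x+p′≡x+[p+c] ⟩
    (p + c) % n      ∎
    where
      open ≡-Reasoning
      x+p′≡x+[p+c] : (x + p′) % n ≡ (x + (p + c)) % n
      x+p′≡x+[p+c] = begin
        (x + p′) % n         ≡⟨ w≡x+p′ ⟨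
        w                    ≡⟨ w≡u+c ⟩
        ((x + p) % n + c) % n ≡⟨ [m%d+n]%d≡[m+n]%d (x + p) c ⟩
        (x + p + c) % n      ≡⟨ cong (_% n) (+-assoc x p c) ⟩
        (x + (p + c)) % n    ∎

  offset-zero : ∀ {x v p} → x < n → p ≡ 0 → v ≡ (x + p) % n → v ≡ x
  offset-zero {x} x<n refl refl = trans (cong (_% n) (+-identityʳ x)) (m<n⇒m%n≡m x<n)

jump-complement : ∀ m e j d → (suc m + e) * d + (2 + e) + ((suc m + e) * j + m) ≡ suc ((suc m + e) * (suc j + d))
jump-complement = solve-∀

module _ (k q : ℕ) (2≤k : 2 ≤ k) where

  private
    instance
      k≢0 : NonZero k
      k≢0 = >-nonZero (≤-trans (s≤s z≤n) 2≤k)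
    n : ℕ
    n = suc (k * q)

  -- u ~ w in G q k iff toℕ w ≡ toℕ u + c (mod n) for a connection c; wrap is the offset −1.
  data Connection : ℕ → Set where
    wrap : Connection (k * q)
    step : Connection 1
    jump : ∀ {j m} → 2 ≤ m → m < k → j < q → Connection (k * j + m)

  adjacent⇒connection : ∀ {u w} → GAdj q k u w → ∃[ c ] Connection c × toℕ w ≡ (toℕ u + c) % n
  adjacent⇒connection (inj₁ w≡u-1) = k * q , wrap , w≡u-1
  adjacent⇒connection (inj₂ (inj₁ w≡u+1)) = 1 , step , w≡u+1
  adjacent⇒connection (inj₂ (inj₂ (m , j , 2≤m , m≤k∸1 , j<q , w≡u+c))) =
    k * j + m , jump 2≤m (≤∸1⇒< m≤k∸1) j<q , w≡u+c

  connection⇒adjacent : ∀ {u w c} → Connection c → toℕ w ≡ (toℕ u + c) % n → GAdj q k u w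
  connection⇒adjacent wrap w≡u+c = inj₁ w≡u+c
  connection⇒adjacent step w≡u+c = inj₂ (inj₁ w≡u+c)
  connection⇒adjacent (jump {j} {m} 2≤m m<k j<q) w≡u+c =
    inj₂ (inj₂ (m , j , 2≤m , <⇒≤∸1 m<k , j<q , w≡u+c))

  Connection-sym : ∀ {c} → Connection c → ∃[ c′ ] Connection c′ × c′ + c ≡ n
  Connection-sym wrap = 1 , step , refl
  Connection-sym step = k * q , wrap , +-comm (k * q) 1
  Connection-sym (jump {j} {m} 2≤m m<k j<q) with m≤n⇒∃[o]m+o≡n m<k | m≤n⇒∃[o]m+o≡n j<q
  ... | e , 1+m+e≡k | d , 1+j+d≡q = k * d + (2 + e) , jump (m≤m+n 2 e) 2+e<k d<q , sum
    where
      2+e<k : 2 + e < k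
      2+e<k = subst (2 + e <_) 1+m+e≡k (+-monoˡ-≤ e (s≤s 2≤m))
      d<q : d < q
      d<q = subst (d <_) 1+j+d≡q (m<n+m d (s≤s z≤n))
      sum : k * d + (2 + e) + (k * j + m) ≡ n
      sum rewrite sym 1+m+e≡k | sym 1+j+d≡q = jump-complement m e j d

  Connection⇒≤n : ∀ {c} → Connection c → c ≤ n
  Connection⇒≤n wrap = n≤1+n (k * q)
  Connection⇒≤n step = s≤s z≤n
  Connection⇒≤n (jump {j} {m} _ m<k j<q) = m≤n⇒m≤1+n (begin
    k * j + m  ≤⟨ +-monoʳ-≤ (k * j) (<⇒≤ m<k) ⟩
    k * j + k  ≡⟨ +-comm (k * j) k ⟩
    k + k * j  ≡⟨ *-suc k j ⟨
    k * suc j  ≤⟨ *-monoʳ-≤ k j<q ⟩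
    k * q      ∎)
    where open ≤-Reasoning

  Connection⇒≡kq⊎k∤ : ∀ {c} → Connection c → c ≡ k * q ⊎ k ∤ c
  Connection⇒≡kq⊎k∤ wrap = inj₁ refl
  Connection⇒≡kq⊎k∤ step = inj₂ (λ k∣1 → <-irrefl (sym (∣1⇒≡1 k∣1)) 2≤k)
  Connection⇒≡kq⊎k∤ (jump {j} {m} 2≤m m<k _) = inj₂ λ k∣c →
    <⇒≱ m<k (∣⇒≤ {{>-nonZero (≤-trans (s≤s z≤n) 2≤m)}} (∣m+n∣m⇒∣n k∣c (m∣m*n j)))

  residue≥2⇒connection : ∀ {p} → p < n → 2 ≤ p % k → Connection p
  residue≥2⇒connection {p} (s≤s p≤kq) 2≤r =
    subst Connection (sym p≡) (jump 2≤r (m%n<n p k) (*-cancelˡ-< k _ _ k[p/k]<kq))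
    where
      p≡ : p ≡ k * (p / k) + p % k
      p≡ = trans (m≡m%n+[m/n]*n p k) (trans (+-comm (p % k) _) (cong (_+ p % k) (*-comm (p / k) k)))
      k[p/k]<kq : k * (p / k) < k * q
      k[p/k]<kq = begin-strict
        k * (p / k)          <⟨ m<m+n _ (≤-trans (s≤s z≤n) 2≤r) ⟩
        k * (p / k) + p % k  ≡⟨ p≡ ⟨
        p                    ≤⟨ p≤kq ⟩
        k * q                ∎
        where open ≤-Reasoning

  connection-shifts-residue : ∀ {p p′ c} → Connection c → 1 ≤ p → p′ ≡ p + c → p′ < n → p′ % k ≢ p % k
  connection-shifts-residue {p} {c = c} conn 1≤p refl p+c<n with Connection⇒≡kq⊎k∤ conn
  ... | inj₁ refl = λ _ → <⇒≱ p+c<n (+-monoˡ-≤ (k * q) 1≤p)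
  ... | inj₂ k∤c = λ eq → k∤c ([m+n]%d≡m%d⇒d∣n p c eq)

  connection-apart⇒residues-differ : ∀ {pu pw c} → Connection c → 1 ≤ pu → 1 ≤ pw → pu < n → pw < n →
                                     pw ≡ (pu + c) % n → pw % k ≢ pu % k
  connection-apart⇒residues-differ {pu} {pw} {c} conn 1≤pu 1≤pw pu<n pw<n pw≡
    with m<n+n⇒m%n≡m⊎m%n+n≡m (pu + c) (+-mono-<-≤ pu<n (Connection⇒≤n conn))
  ... | inj₁ no-wrap = connection-shifts-residue conn 1≤pu (trans pw≡ no-wrap) pw<n
  ... | inj₂ wrap-around with Connection-sym conn
  ... | c′ , conn′ , c′+c≡n = ≢-sym (connection-shifts-residue conn′ 1≤pw pu≡pw+c′ pu<n)
    where
      open ≡-Reasoning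
      pu≡pw+c′ : pu ≡ pw + c′
      pu≡pw+c′ = +-cancelʳ-≡ c pu (pw + c′) (begin
        pu + c           ≡⟨ wrap-around ⟨
        (pu + c) % n + n ≡⟨ cong (_+ n) pw≡ ⟨
        pw + n           ≡⟨ cong (pw +_) c′+c≡n ⟨
        pw + (c′ + c)    ≡⟨ +-assoc pw c′ c ⟨
        pw + c′ + c      ∎)

  adjacent⇒residues-differ : ∀ (x u w : Fin n) {pu pw} → 1 ≤ pu → 1 ≤ pw → pu < n → pw < n →
    toℕ u ≡ (toℕ x + pu) % n → toℕ w ≡ (toℕ x + pw) % n → GAdj q k u w → pw % k ≢ pu % k
  adjacent⇒residues-differ x u w {pu} 1≤pu 1≤pw pu<n pw<n u≡x+pu w≡x+pw adj
    with adjacent⇒connection {u} {w} adj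
  ... | c , conn , w≡u+c = connection-apart⇒residues-differ conn 1≤pu 1≤pw pu<n pw<n
    (offset-+ {x = toℕ x} {p = pu} {c = c} pw<n u≡x+pu w≡x+pw w≡u+c)

  nonadjacent⇒residue≤1 : ∀ (x v : Fin n) {p} → p < n → toℕ v ≡ (toℕ x + p) % n →
                          ¬ GAdj q k x v → p % k ≤ 1
  nonadjacent⇒residue≤1 x v {p} p<n v≡x+p ¬adj with p % k ≤? 1
  ... | yes r≤1 = r≤1
  ... | no r≰1 = ⊥-elim (¬adj (connection⇒adjacent {x} {v} (residue≥2⇒connection p<n (≰⇒> r≰1)) v≡x+p))

  G-K3+P1-free : (K3+P1 -free) (G q k)
  G-K3+P1-free (f , f-injective , f-adj) =
    no-three-distinct-≤1 (residue≤1 (# 0)) (residue≤1 (# 1)) (residue≤1 (# 2))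
      (residues-differ (# 0) (# 1) z<s (s<s z<s) λ ())
      (residues-differ (# 0) (# 2) z<s (s<s (s<s z<s)) λ ())
      (residues-differ (# 1) (# 2) (s<s z<s) (s<s (s<s z<s)) λ ())
    where
      x : Fin n
      x = f (# 3)
      offset : ∀ i → ∃[ p ] p < n × toℕ (f i) ≡ (toℕ x + p) % n
      offset i = offset-exists (toℕ<n x) (toℕ<n (f i))
      p : Fin 4 → ℕ
      p i = proj₁ (offset i)
      p<n : ∀ i → p i < n
      p<n i = proj₁ (proj₂ (offset i))
      f≡x+p : ∀ i → toℕ (f i) ≡ (toℕ x + p i) % n
      f≡x+p i = proj₂ (proj₂ (offset i))
      residue≤1 : ∀ i → p i % k ≤ 1
      residue≤1 i = nonadjacent⇒residue≤1 x (f i) (p<n i) (f≡x+p i)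
        (λ adj → <-irrefl refl (proj₁ (Equivalence.from (f-adj (# 3) i) adj)))
      positive : ∀ i → toℕ i < 3 → 1 ≤ p i
      positive i i<3 = n≢0⇒n>0 λ p≡0 → <-irrefl (cong toℕ (f-injective i (# 3)
        (toℕ-injective (offset-zero (toℕ<n x) p≡0 (f≡x+p i))))) i<3
      residues-differ : ∀ i j → toℕ i < 3 → toℕ j < 3 → i ≢ j → p j % k ≢ p i % k
      residues-differ i j i<3 j<3 i≢j =
        adjacent⇒residues-differ x (f i) (f j) (positive i i<3) (positive j j<3) (p<n i) (p<n j)
          (f≡x+p i) (f≡x+p j)
          (Equivalence.to (f-adj i j) (i<3 , j<3 , i≢j))

-- The argument needs only 2 ≤ k, and no bound on q.
lemma2p4 : (k q : ℕ) → 4 ≤ k → 1 ≤ q → (K3+P1 -free) (G q k)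
lemma2p4 k q 4≤k _ = G-K3+P1-free k q (≤-trans (s≤s (s≤s z≤n)) 4≤k)
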